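{- Every up-rule of $\mathsf P{\uparrow}$ is admissible in $\mathsf P{\downarrow}$: for every context $S\{\ \}$ and every instance of a rule of $\mathsf P{\uparrow}$ with premise $E$ and conclusion $F$, if there is a derivation in $\mathsf P{\downarrow}$ from $\mathtt T$ to $S\{E\}$, then there is a derivation in $\mathsf P{\downarrow}$ from $\mathtt T$ to $S\{F\}$.
   Context: Formulas: $A,B::=\mathtt T\mid\mathtt F\mid x\mid\overline x\mid A\wedge B\mid A\,\pi_0\,B\mid A\,\pi_1\,B\mid A\vee B$, where $x$ ranges over a set of variables and $\pi_0,\pi_1$ are binary relation symbols (projections). Negation is the involution $\overline{\mathtt T}=\mathtt F$, $\overline{\mathtt F}=\mathtt T$, $\overline{\overline x}=x$, $\overline{A\vee B}=\overline A\wedge\overline B$, $\overline{A\wedge B}=\overline A\vee\overline B$, $\overline{A\,\pi_i\,B}=\overline A\,\pi_i\,\overline B$. The congruence $=_{\mathsf P}$ is generated by: associativity of $\wedge,\vee,\pi_0,\pi_1$; commutativity of $\wedge,\vee$; $A\vee\mathtt F=A$; $A\,\pi_0\,B=A$; $A\,\pi_1\,B=B$; $u\wedge\mathtt F=\mathtt F$ for $u\in\{\mathtt F,\mathtt T\}$; $u\vee\overline u=\mathtt T$ for $u\in\{\mathtt F,\mathtt T\}$; $x\vee\overline x=\mathtt T$ for every variable $x$; $u\vee u=u$ for $u\in\{\mathtt F,\mathtt T\}$; $x\vee x=x$ for every variable $x$; together with the negated versions $\overline E=\overline F$ of all these axioms. The system $\mathsf P{\downarrow}$ has the rules (premise $\Rightarrow$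 conclusion, $j\in\{0,1\}$, arbitrary formulas $A,B,C,D$): $ai_j{\downarrow}$: $(A\vee B)\pi_j(C\vee D)\Rightarrow(A\pi_jC)\vee(B\pi_jD)$; $s{\downarrow}$: $(A\vee B)\wedge(C\vee D)\Rightarrow(A\wedge C)\vee(B\vee D)$. The up-fragment $\mathsf P{\uparrow}$ has the rules $ai_j{\uparrow}$: $(A\pi_jC)\wedge(B\pi_jD)\Rightarrow(A\wedge B)\pi_j(C\wedge D)$ ($j\in\{0,1\}$) and $s{\uparrow}$: $(A\vee C)\wedge(B\wedge D)\Rightarrow(A\wedge B)\vee(C\wedge D)$. A context $S\{\ \}$ is a formula with one subformula occurrence replaced by a hole. A derivation in $\mathsf P{\downarrow}$ from $A$ to $B$ is a finite sequence of formulas from $A$ to $B$ in which each step replaces, inside some context, the premise of an instance of a rule of $\mathsf P{\downarrow}$ by its conclusion, formulas being taken modulo $=_{\mathsf P}$. -}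

module Defs where

data Proj : Set where
  p0 p1 : Proj

data Form (V : Set) : Set where
  𝕋 𝔽 : Form V
  var  : V → Form V
  nvar : V → Form V
  _∧_  : Form V → Form V → Form V
  _π[_]_ : Form V → Proj → Form V → Form V
  _∨_  : Form V → Form V → Form V

infixr 6 _∧_
infixr 5 _∨_
infixr 7 _π[_]_

module _ {V : Set} where

  neg : Form V → Form V
  neg 𝕋 = 𝔽
  neg 𝔽 = 𝕋
  neg (var x) = nvar x
  neg (nvar x) = var x
  neg (A ∧ B) = neg A ∨ neg B
  neg (A π[ j ] B) = neg A π[ j ] neg B
  neg (A ∨ B) = neg A ∧ neg B

  data Unit : Form V → Set where
    u𝕋 : Unit 𝕋
    u𝔽 : Unit 𝔽

  -- the generating axioms E = F of =P (unnegated versions)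
  data Ax : Form V → Form V → Set where
    ∧-assoc : ∀ A B C → Ax ((A ∧ B) ∧ C) (A ∧ (B ∧ C))
    ∨-assoc : ∀ A B C → Ax ((A ∨ B) ∨ C) (A ∨ (B ∨ C))
    π-assoc : ∀ j A B C → Ax ((A π[ j ] B) π[ j ] C) (A π[ j ] (B π[ j ] C))
    ∧-comm  : ∀ A B → Ax (A ∧ B) (B ∧ A)
    ∨-comm  : ∀ A B → Ax (A ∨ B) (B ∨ A)
    ∨-unit  : ∀ A → Ax (A ∨ 𝔽) A
    π0-proj : ∀ A B → Ax (A π[ p0 ] B) A
    π1-proj : ∀ A B → Ax (A π[ p1 ] B) B
    u∧𝔽     : ∀ {u} → Unit u → Ax (u ∧ 𝔽) 𝔽
    u∨ū     : ∀ {u} → Unit u → Ax (u ∨ neg u) 𝕋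
    x∨x̄     : ∀ x → Ax (var x ∨ nvar x) 𝕋
    u∨u     : ∀ {u} → Unit u → Ax (u ∨ u) u
    x∨x     : ∀ x → Ax (var x ∨ var x) (var x)

  infix 4 _=P_
  data _=P_ : Form V → Form V → Set where
    ax     : ∀ {E F} → Ax E F → E =P F
    ax-neg : ∀ {E F} → Ax E F → neg E =P neg F
    refl'  : ∀ {A} → A =P A
    sym'   : ∀ {A B} → A =P B → B =P A
    trans' : ∀ {A B C} → A =P B → B =P C → A =P C
    ∧-cong : ∀ {A A' B B'} → A =P A' → B =P B' → (A ∧ B) =P (A' ∧ B')
    ∨-cong : ∀ {A A' B B'} → A =P A' → B =P B' → (A ∨ B) =P (A' ∨ B')
    π-cong : ∀ {j A A' B B'} → A =P A' → B =P B' → (A π[ j ] B) =P (A' π[ j ] B')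

  data Ctx : Set where
    □    : Ctx
    _∧ˡ_ : Ctx → Form V → Ctx
    _∧ʳ_ : Form V → Ctx → Ctx
    _∨ˡ_ : Ctx → Form V → Ctx
    _∨ʳ_ : Form V → Ctx → Ctx
    _πˡ[_]_ : Ctx → Proj → Form V → Ctx
    _πʳ[_]_ : Form V → Proj → Ctx → Ctx

  _⟦_⟧ : Ctx → Form V → Form V
  □ ⟦ A ⟧ = A
  (S ∧ˡ B) ⟦ A ⟧ = (S ⟦ A ⟧) ∧ B
  (B ∧ʳ S) ⟦ A ⟧ = B ∧ (S ⟦ A ⟧)
  (S ∨ˡ B) ⟦ A ⟧ = (S ⟦ A ⟧) ∨ B
  (B ∨ʳ S) ⟦ A ⟧ = B ∨ (S ⟦ A ⟧)
  (S πˡ[ j ] B) ⟦ A ⟧ = (S ⟦ A ⟧) π[ j ] B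
  (B πʳ[ j ] S) ⟦ A ⟧ = B π[ j ] (S ⟦ A ⟧)

  data Down : Form V → Form V → Set where
    ai↓ : ∀ j A B C D →
          Down ((A ∨ B) π[ j ] (C ∨ D)) ((A π[ j ] C) ∨ (B π[ j ] D))
    s↓  : ∀ A B C D →
          Down ((A ∨ B) ∧ (C ∨ D)) ((A ∧ C) ∨ (B ∨ D))

  data Up : Form V → Form V → Set where
    ai↑ : ∀ j A B C D →
          Up ((A π[ j ] C) ∧ (B π[ j ] D)) ((A ∧ B) π[ j ] (C ∧ D))
    s↑  : ∀ A B C D →
          Up ((A ∨ C) ∧ (B ∧ D)) ((A ∧ B) ∨ (C ∧ D))

  data Step↓ (A B : Form V) : Set where
    step : (S : Ctx) (P C : Form V) → A =P S ⟦ P ⟧ → Down P C →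
           S ⟦ C ⟧ =P B → Step↓ A B

  data Deriv↓ : Form V → Form V → Set where
    done : ∀ {A B} → A =P B → Deriv↓ A B
    _∷_  : ∀ {A B C} → Step↓ A B → Deriv↓ B C → Deriv↓ A C

module Submission where

-- Derivability in P↓ is closed under contexts and under composition, so it
-- suffices that every up-rule instance E ⇒ F is itself derivable from E to F
-- in P↓.  For ai↑ no step is needed: π_j is a projection modulo =P, so premise
-- and conclusion are =P-equal.  For s↑, s↓ with a unit 𝔽 padded in yields the
-- switch (A ∨ C) ∧ B ⇒ (A ∧ B) ∨ C, and two switches give s↑.

open import Defs
open import Relation.Binary.PropositionalEquality using (_≡_; refl; cong; sym)

module _ {V : Set} where

  infixl 8 _∘ᶜ_

  _∘ᶜ_ : Ctx {V} → Ctx {V} → Ctx {V}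
  □ ∘ᶜ T = T
  (S ∧ˡ B) ∘ᶜ T = (S ∘ᶜ T) ∧ˡ B
  (B ∧ʳ S) ∘ᶜ T = B ∧ʳ (S ∘ᶜ T)
  (S ∨ˡ B) ∘ᶜ T = (S ∘ᶜ T) ∨ˡ B
  (B ∨ʳ S) ∘ᶜ T = B ∨ʳ (S ∘ᶜ T)
  (S πˡ[ j ] B) ∘ᶜ T = (S ∘ᶜ T) πˡ[ j ] B
  (B πʳ[ j ] S) ∘ᶜ T = B πʳ[ j ] (S ∘ᶜ T)

  ⟦⟧-∘ᶜ : (S T : Ctx {V}) (P : Form V) → S ⟦ T ⟦ P ⟧ ⟧ ≡ (S ∘ᶜ T) ⟦ P ⟧
  ⟦⟧-∘ᶜ □ T P = refl
  ⟦⟧-∘ᶜ (S ∧ˡ B) T P = cong (_∧ B) (⟦⟧-∘ᶜ S T P)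
  ⟦⟧-∘ᶜ (B ∧ʳ S) T P = cong (B ∧_) (⟦⟧-∘ᶜ S T P)
  ⟦⟧-∘ᶜ (S ∨ˡ B) T P = cong (_∨ B) (⟦⟧-∘ᶜ S T P)
  ⟦⟧-∘ᶜ (B ∨ʳ S) T P = cong (B ∨_) (⟦⟧-∘ᶜ S T P)
  ⟦⟧-∘ᶜ (S πˡ[ j ] B) T P = cong (_π[ j ] B) (⟦⟧-∘ᶜ S T P)
  ⟦⟧-∘ᶜ (B πʳ[ j ] S) T P = cong (B π[ j ]_) (⟦⟧-∘ᶜ S T P)

  ≡⇒=P : {A B : Form V} → A ≡ B → A =P B
  ≡⇒=P refl = refl'

  ⟦⟧-cong : (S : Ctx {V}) {A B : Form V} → A =P B → S ⟦ A ⟧ =P S ⟦ B ⟧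
  ⟦⟧-cong □ e = e
  ⟦⟧-cong (S ∧ˡ B) e = ∧-cong (⟦⟧-cong S e) refl'
  ⟦⟧-cong (B ∧ʳ S) e = ∧-cong refl' (⟦⟧-cong S e)
  ⟦⟧-cong (S ∨ˡ B) e = ∨-cong (⟦⟧-cong S e) refl'
  ⟦⟧-cong (B ∨ʳ S) e = ∨-cong refl' (⟦⟧-cong S e)
  ⟦⟧-cong (S πˡ[ j ] B) e = π-cong (⟦⟧-cong S e) refl'
  ⟦⟧-cong (B πʳ[ j ] S) e = π-cong refl' (⟦⟧-cong S e)

  Step↓-inCtx : (S : Ctx {V}) {A B : Form V} →
                Step↓ A B → Step↓ (S ⟦ A ⟧) (S ⟦ B ⟧)
  Step↓-inCtx S (step T P C A=T[P] rule T[C]=B) =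
    step (S ∘ᶜ T) P C
         (trans' (⟦⟧-cong S A=T[P]) (≡⇒=P (⟦⟧-∘ᶜ S T P)))
         rule
         (trans' (≡⇒=P (sym (⟦⟧-∘ᶜ S T C))) (⟦⟧-cong S T[C]=B))

  Deriv↓-inCtx : (S : Ctx {V}) {A B : Form V} →
                 Deriv↓ A B → Deriv↓ (S ⟦ A ⟧) (S ⟦ B ⟧)
  Deriv↓-inCtx S (done e) = done (⟦⟧-cong S e)
  Deriv↓-inCtx S (s ∷ d) = Step↓-inCtx S s ∷ Deriv↓-inCtx S d

  =P-Deriv↓-trans : {A B C : Form V} → A =P B → Deriv↓ B C → Deriv↓ A C
  =P-Deriv↓-trans e (done e') = done (trans' e e')
  =P-Deriv↓-trans e (step T P C e₁ rule e₂ ∷ d) = step T P C (trans' e e₁) rule e₂ ∷ d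

  Deriv↓-=P-trans : {A B C : Form V} → Deriv↓ A B → B =P C → Deriv↓ A C
  Deriv↓-=P-trans (done e) e' = done (trans' e e')
  Deriv↓-=P-trans (s ∷ d) e' = s ∷ Deriv↓-=P-trans d e'

  Deriv↓-trans : {A B C : Form V} → Deriv↓ A B → Deriv↓ B C → Deriv↓ A C
  Deriv↓-trans (done e) d = =P-Deriv↓-trans e d
  Deriv↓-trans (s ∷ d) d' = s ∷ Deriv↓-trans d d'

  ai↑-=P : (j : Proj) (A B C D : Form V) →
           (A π[ j ] C) ∧ (B π[ j ] D) =P (A ∧ B) π[ j ] (C ∧ D)
  ai↑-=P p0 A B C D =
    trans' (∧-cong (ax (π0-proj A C)) (ax (π0-proj B D)))
           (sym' (ax (π0-proj (A ∧ B) (C ∧ D))))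
  ai↑-=P p1 A B C D =
    trans' (∧-cong (ax (π1-proj A C)) (ax (π1-proj B D)))
           (sym' (ax (π1-proj (A ∧ B) (C ∧ D))))

  switch↓ : (A B C : Form V) → Deriv↓ ((A ∨ C) ∧ B) ((A ∧ B) ∨ C)
  switch↓ A B C =
    step □ ((A ∨ C) ∧ (B ∨ 𝔽)) ((A ∧ B) ∨ (C ∨ 𝔽))
         (∧-cong refl' (sym' (ax (∨-unit B))))
         (s↓ A C B 𝔽)
         (∨-cong refl' (ax (∨-unit C)))
    ∷ done refl'

  s↑-Deriv↓ : (A B C D : Form V) →
              Deriv↓ ((A ∨ C) ∧ (B ∧ D)) ((A ∧ B) ∨ (C ∧ D))
  s↑-Deriv↓ A B C D =
    =P-Deriv↓-trans (sym' (ax (∧-assoc (A ∨ C) B D)))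
      (Deriv↓-trans (Deriv↓-inCtx (□ ∧ˡ D) (switch↓ A B C))
        (=P-Deriv↓-trans (∧-cong (ax (∨-comm (A ∧ B) C)) refl')
          (Deriv↓-=P-trans (switch↓ C D (A ∧ B)) (ax (∨-comm (C ∧ D) (A ∧ B))))))

  Up⇒Deriv↓ : {E F : Form V} → Up E F → Deriv↓ E F
  Up⇒Deriv↓ (ai↑ j A B C D) = done (ai↑-=P j A B C D)
  Up⇒Deriv↓ (s↑ A B C D) = s↑-Deriv↓ A B C D

corollary3 : {V : Set} (S : Ctx {V}) (E F : Form V) → Up E F →
    Deriv↓ 𝕋 (S ⟦ E ⟧) → Deriv↓ 𝕋 (S ⟦ F ⟧)
corollary3 S E F up 𝕋⇒S[E] = Deriv↓-trans 𝕋⇒S[E] (Deriv↓-inCtx S (Up⇒Deriv↓ up))
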